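{- For $n\geq 1$, the number of permutations $\pi\in\mathcal{S}_n$ that have at most one descent and are involutions (i.e. $\pi^2$ is the identity) equals $\left\lfloor \frac{n^2}{4}\right\rfloor+1$.
   Context: $\mathcal{S}_n$ is the symmetric group on $[n]$; a permutation $\pi=\pi_1\cdots\pi_n$ (one-line notation) has a descent at $i\in[n-1]$ if $\pi_i>\pi_{i+1}$. Powers are under composition. -}

module Defs where

open import Data.Nat using (ℕ; suc; _<_; _*_; _/_; _+_)
open import Data.Nat.Properties using (<-trans; n<1+n)
open import Data.Fin using (Fin; fromℕ<) renaming (_<_ to _<ᶠ_)
open import Data.Fin.Permutation using (Permutation′; _⟨$⟩ʳ_; _∘ₚ_; id)
open import Data.List using (List; length)
open import Data.List.Relation.Unary.All using (All)
open import Data.List.Relation.Unary.Any using (Any)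
open import Data.List.Relation.Unary.AllPairs using (AllPairs)
open import Relation.Binary.PropositionalEquality using (_≡_)
open import Relation.Nullary using (¬_)
open import Data.Product using (_×_)

-- A permutation of [n] is a bijection Fin n ↔ Fin n (0-based positions and values),
-- one-line notation: π_i = π ⟨$⟩ʳ i.

_≈ₚ_ : ∀ {n} → Permutation′ n → Permutation′ n → Set
_≈ₚ_ {n} π σ = (i : Fin n) → π ⟨$⟩ʳ i ≡ σ ⟨$⟩ʳ i

HasDescentAt : ∀ {n} → Permutation′ n → (i : ℕ) → suc i < n → Set
HasDescentAt π i p = (π ⟨$⟩ʳ fromℕ< p) <ᶠ (π ⟨$⟩ʳ fromℕ< (<-trans (n<1+n i) p))

AtMostOneDescent : ∀ {n} → Permutation′ n → Set
AtMostOneDescent {n} π =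
  (i j : ℕ) (p : suc i < n) (q : suc j < n) →
  HasDescentAt π i p → HasDescentAt π j q → i ≡ j

IsInvolution : ∀ {n} → Permutation′ n → Set
IsInvolution π = (π ∘ₚ π) ≈ₚ id

Good : ∀ {n} → Permutation′ n → Set
Good π = AtMostOneDescent π × IsInvolution π

CountIs : (n : ℕ) → (Permutation′ n → Set) → ℕ → Set
CountIs n P k =
  Data.Product.Σ (List (Permutation′ n)) λ L →
    length L ≡ k
    × All P L
    × AllPairs (λ π σ → ¬ (π ≈ₚ σ)) L
    × ((π : Permutation′ n) → P π → Any (π ≈ₚ_) L)

-- Extend a permutation of [n] by the identity to a map g : ℕ → ℕ. If g is an involution with
-- at most one descent, at d, then g is increasing on [0, d] and on [d + 1, ∞), hence expanding
-- there (g (i + k) ≥ g i + k), and an involution that is increasing on a set fixes every point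
-- of the set that it maps back into the set. With a = g (d + 1) and a + b = d + 1 this forces g
-- to be the block swap exchanging [a, a + b) with [a + b, a + 2b), and a + 2b ≤ n; without a
-- descent g is the identity. Conversely every such block swap with b ≥ 1 is an involution with
-- exactly one descent. There are ⌊m/2⌋ pairs with a + 2b = m, and ⌊n/2⌋ + ⌊(n+1)/2⌋ = n, so
-- passing from n to n + 2 adds n + 1 pairs; as (n + 2)² = n² + 4 (n + 1), there are ⌊n²/4⌋.
module Submission where

open import Data.Bool.Base using (if_then_else_)
open import Data.Fin.Base using (Fin; toℕ; fromℕ<)
open import Data.Fin.Permutation using (Permutation′; _⟨$⟩ʳ_; id; permutation)
open import Data.Fin.Properties using (toℕ-fromℕ<; fromℕ<-toℕ; toℕ<n; toℕ-injective)
open import Data.List.Base using (List; []; _∷_; map; _++_; length)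
open import Data.List.Membership.Propositional using (_∈_)
open import Data.List.Membership.Propositional.Properties using (∈-map⁺; ∈-++⁺ˡ; ∈-++⁺ʳ)
open import Data.List.Properties using (length-map; length-++)
open import Data.List.Relation.Unary.All as All using (All; []; _∷_)
import Data.List.Relation.Unary.All.Properties as All
open import Data.List.Relation.Unary.AllPairs as AllPairs using (AllPairs; []; _∷_)
import Data.List.Relation.Unary.AllPairs.Properties as AllPairs
open import Data.List.Relation.Unary.Any as Any using (Any; here; there)
open import Data.Nat.Base
open import Data.Nat.DivMod using (m*n/n≡m; +-distrib-/-∣ʳ)
open import Data.Nat.Divisibility using (n∣m*n)
open import Data.Nat.Properties
open import Data.Nat.Tactic.RingSolver using (solve-∀)
open import Data.Product.Base using (∃-syntax; ∃₂; _×_; _,_; proj₂; map₂)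
open import Data.Sum.Base using (_⊎_; inj₁; inj₂)
open import Data.Unit.Base using (⊤; tt)
open import Function.Bundles using (_⇔_; mk⇔; Equivalence)
open import Relation.Binary.Definitions using (tri<; tri≈; tri>)
open import Relation.Binary.PropositionalEquality
open import Relation.Nullary using (¬_; does; yes; no)
open import Relation.Nullary.Decidable using (dec-true; dec-false)
open import Relation.Nullary.Negation using (contradiction)

open import Algebra.Definitions {A = ℕ} _≡_ using (Involutive)
open import Algebra.Properties.CommutativeSemigroup +-commutativeSemigroup using (xy∙z≈xz∙y)
open import Defs

AllPairs-mapWith-All : ∀ {A : Set} {P : A → Set} {R S : A → A → Set} →
                       (∀ {x y} → P x → P y → R x y → S x y) →
                       ∀ {xs} → All P xs → AllPairs R xs → AllPairs S xs
AllPairs-mapWith-All f []         []         = []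
AllPairs-mapWith-All f (px ∷ pxs) (Rx ∷ Rxs) =
  All.zipWith (λ (py , r) → f px py r) (pxs , Rx) ∷ AllPairs-mapWith-All f pxs Rxs

Descent : (ℕ → ℕ) → ℕ → Set
Descent g i = g (suc i) < g i

AtMostOneDescentℕ : (ℕ → ℕ) → Set
AtMostOneDescentℕ g = ∀ i j → Descent g i → Descent g j → i ≡ j

Expanding : (ℕ → ℕ) → (ℕ → Set) → Set
Expanding g R = ∀ i k → R i → R (i + k) → g i + k ≤ g (i + k)

module _ {g : ℕ → ℕ} where

  ascents⇒expanding : ∀ i k → (∀ t → t < k → g (i + t) < g (suc (i + t))) → g i + k ≤ g (i + k)
  ascents⇒expanding i zero _ = ≤-reflexive (trans (+-identityʳ (g i)) (cong g (sym (+-identityʳ i))))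
  ascents⇒expanding i (suc k) ascent = begin
    g i + suc k      ≡⟨ +-suc (g i) k ⟩
    suc (g i + k)    ≤⟨ s≤s (ascents⇒expanding i k (λ t t<k → ascent t (m<n⇒m<1+n t<k))) ⟩
    suc (g (i + k))  ≤⟨ ascent k (n<1+n k) ⟩
    g (suc (i + k))  ≡⟨ cong g (sym (+-suc i k)) ⟩
    g (i + suc k)    ∎
    where open ≤-Reasoning

  module _ {R : ℕ → Set} (expanding : Expanding g R) where

    expanding⇒< : ∀ {i j} → R i → R j → i < j → g i < g j
    expanding⇒< {i} Ri Rj i<j with m≤n⇒∃[o]m+o≡n i<j
    ... | k , refl = begin-strict
      g i            <⟨ m<m+n (g i) z<s ⟩
      g i + suc k    ≤⟨ expanding i (suc k) Ri (subst R (sym (+-suc i k)) Rj) ⟩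
      g (i + suc k)  ≡⟨ cong g (+-suc i k) ⟩
      g (suc i + k)  ∎
      where open ≤-Reasoning

    expanding-involution-fixed : Involutive g → ∀ {i} → R i → R (g i) → g i ≡ i
    expanding-involution-fixed involutive {i} Ri Rgi with <-cmp (g i) i
    ... | tri≈ _ gi≡i _ = gi≡i
    ... | tri< gi<i _ _ =
      contradiction (subst (_< g i) (involutive i) (expanding⇒< Rgi Ri gi<i)) (<-asym gi<i)
    ... | tri> _ _ i<gi =
      contradiction (subst (g i <_) (involutive i) (expanding⇒< Ri Rgi i<gi)) (<-asym i<gi)

-- Opaque, so that a and b can be inferred from blockSwap a b; the four evaluation lemmas
-- below are its whole interface.
opaque
  blockSwap : ℕ → ℕ → ℕ → ℕ
  blockSwap a b i =
    if does (i <? a) then i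
    else if does (i <? a + b) then i + b
    else if does (i <? a + b + b) then i ∸ b
    else i

module _ {a b : ℕ} where

  private
    a≤a+b+t : ∀ t → a ≤ a + b + t
    a≤a+b+t t = ≤-trans (m≤m+n a b) (m≤m+n (a + b) t)

  opaque
    unfolding blockSwap

    blockSwap-below : ∀ {i} → i < a → blockSwap a b i ≡ i
    blockSwap-below {i} i<a rewrite dec-true (i <? a) i<a = refl

    blockSwap-first : ∀ {t} → t < b → blockSwap a b (a + t) ≡ a + b + t
    blockSwap-first {t} t<b
      rewrite dec-false (a + t <? a) (m+n≮m a t)
            | dec-true (a + t <? a + b) (+-monoʳ-< a t<b) = xy∙z≈xz∙y a t b

    blockSwap-second : ∀ {t} → t < b → blockSwap a b (a + b + t) ≡ a + t
    blockSwap-second {t} t<b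
      rewrite dec-false (a + b + t <? a) (≤⇒≯ (a≤a+b+t t))
            | dec-false (a + b + t <? a + b) (m+n≮m (a + b) t)
            | dec-true (a + b + t <? a + b + b) (+-monoʳ-< (a + b) t<b) =
      trans (cong (_∸ b) (xy∙z≈xz∙y a b t)) (m+n∸n≡m (a + t) b)

    blockSwap-above : ∀ {i} → a + b + b ≤ i → blockSwap a b i ≡ i
    blockSwap-above {i} a+2b≤i
      rewrite dec-false (i <? a) (≤⇒≯ (≤-trans (a≤a+b+t b) a+2b≤i))
            | dec-false (i <? a + b) (≤⇒≯ (≤-trans (m≤m+n (a + b) b) a+2b≤i))
            | dec-false (i <? a + b + b) (≤⇒≯ a+2b≤i) = refl

data Region (a b : ℕ) : ℕ → Set where
  below  : ∀ {i} → i < a → Region a b i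
  first  : ∀ t → t < b → Region a b (a + t)
  second : ∀ t → t < b → Region a b (a + b + t)
  above  : ∀ {i} → a + b + b ≤ i → Region a b i

offset : ∀ p {q i} → p ≤ i → i < p + q → ∃[ t ] t < q × p + t ≡ i
offset p {q} {i} p≤i i<p+q =
  i ∸ p , subst (i ∸ p <_) (m+n∸m≡n p q) (∸-monoˡ-< i<p+q p≤i) , m+[n∸m]≡n p≤i

region : ∀ a b i → Region a b i
region a b i with i <? a | i <? a + b | i <? a + b + b
... | yes i<a | _ | _ = below i<a
... | no i≮a | yes i<a+b | _ with offset a (≮⇒≥ i≮a) i<a+b
...   | t , t<b , refl = first t t<b
region a b i | no _ | no i≮a+b | yes i<a+2b with offset (a + b) (≮⇒≥ i≮a+b) i<a+2b
...   | t , t<b , refl = second t t<b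
region a b i | no _ | no _ | no i≮a+2b = above (≮⇒≥ i≮a+2b)

module _ {a b : ℕ} where

  blockSwap-involutive : Involutive (blockSwap a b)
  blockSwap-involutive i with region a b i
  ... | below i<a    = trans (cong (blockSwap a b) (blockSwap-below i<a)) (blockSwap-below i<a)
  ... | first t t<b  = trans (cong (blockSwap a b) (blockSwap-first t<b)) (blockSwap-second t<b)
  ... | second t t<b = trans (cong (blockSwap a b) (blockSwap-second t<b)) (blockSwap-first t<b)
  ... | above a+2b≤i = trans (cong (blockSwap a b) (blockSwap-above a+2b≤i)) (blockSwap-above a+2b≤i)

  blockSwap-< : ∀ {n i} → a + b + b ≤ n → i < n → blockSwap a b i < n
  blockSwap-< {n} {i} fits i<n with region a b i
  ... | below i<a    = subst (_< n) (sym (blockSwap-below i<a)) i<n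
  ... | first t t<b  = subst (_< n) (sym (blockSwap-first t<b)) (<-≤-trans (+-monoʳ-< (a + b) t<b) fits)
  ... | second t t<b =
    subst (_< n) (sym (blockSwap-second t<b)) (≤-<-trans (+-monoˡ-≤ t (m≤m+n a b)) i<n)
  ... | above a+2b≤i = subst (_< n) (sym (blockSwap-above a+2b≤i)) i<n

  blockSwap-moves-a : 0 < b → blockSwap a b a ≡ a + b
  blockSwap-moves-a 0<b = begin
    blockSwap a b a        ≡⟨ cong (blockSwap a b) (sym (+-identityʳ a)) ⟩
    blockSwap a b (a + 0)  ≡⟨ blockSwap-first 0<b ⟩
    a + b + 0              ≡⟨ +-identityʳ (a + b) ⟩
    a + b                  ∎
    where open ≡-Reasoning

  private
    inflationary-below : ∀ {j} → j < a + b → j ≤ blockSwap a b j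
    inflationary-below {j} j<a+b with region a b j
    ... | below j<a    = ≤-reflexive (sym (blockSwap-below j<a))
    ... | first t t<b  = ≤-trans (+-monoˡ-≤ t (m≤m+n a b)) (≤-reflexive (sym (blockSwap-first t<b)))
    ... | second t _   = contradiction j<a+b (m+n≮m (a + b) t)
    ... | above a+2b≤j = contradiction j<a+b (≤⇒≯ (≤-trans (m≤m+n (a + b) b) a+2b≤j))

    ascent-first : ∀ {t} → suc t < b → blockSwap a b (a + t) < blockSwap a b (suc (a + t))
    ascent-first {t} 1+t<b = begin-strict
      blockSwap a b (a + t)        ≡⟨ blockSwap-first (<-trans (n<1+n t) 1+t<b) ⟩
      a + b + t                    <⟨ n<1+n _ ⟩
      suc (a + b + t)              ≡⟨ sym (+-suc (a + b) t) ⟩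
      a + b + suc t                ≡⟨ sym (blockSwap-first 1+t<b) ⟩
      blockSwap a b (a + suc t)    ≡⟨ cong (blockSwap a b) (+-suc a t) ⟩
      blockSwap a b (suc (a + t))  ∎
      where open ≤-Reasoning

    ascent-second : ∀ {t} → t < b → blockSwap a b (a + b + t) < blockSwap a b (suc (a + b + t))
    ascent-second {t} t<b with m≤n⇒m<n∨m≡n t<b
    ... | inj₁ 1+t<b = begin-strict
      blockSwap a b (a + b + t)        ≡⟨ blockSwap-second t<b ⟩
      a + t                            <⟨ +-monoʳ-< a (n<1+n t) ⟩
      a + suc t                        ≡⟨ sym (blockSwap-second 1+t<b) ⟩
      blockSwap a b (a + b + suc t)    ≡⟨ cong (blockSwap a b) (+-suc (a + b) t) ⟩
      blockSwap a b (suc (a + b + t))  ∎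
      where open ≤-Reasoning
    ... | inj₂ 1+t≡b = begin-strict
      blockSwap a b (a + b + t)        ≡⟨ blockSwap-second t<b ⟩
      a + t                            ≤⟨ +-monoˡ-≤ t (m≤m+n a b) ⟩
      a + b + t                        <⟨ n<1+n _ ⟩
      suc (a + b + t)                  ≡⟨ sym (blockSwap-above a+2b≤1+a+b+t) ⟩
      blockSwap a b (suc (a + b + t))  ∎
      where
      open ≤-Reasoning
      a+2b≤1+a+b+t : a + b + b ≤ suc (a + b + t)
      a+2b≤1+a+b+t = ≤-reflexive (trans (cong (a + b +_) (sym 1+t≡b)) (+-suc (a + b) t))

  blockSwap-ascent : ∀ {i} → suc i ≢ a + b → blockSwap a b i < blockSwap a b (suc i)
  blockSwap-ascent {i} 1+i≢a+b with region a b i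
  ... | below i<a = begin-strict
    blockSwap a b i        ≡⟨ blockSwap-below i<a ⟩
    i                      <⟨ inflationary-below (≤∧≢⇒< (≤-trans i<a (m≤m+n a b)) 1+i≢a+b) ⟩
    blockSwap a b (suc i)  ∎
    where open ≤-Reasoning
  ... | first t t<b =
    ascent-first (≤∧≢⇒< t<b (λ 1+t≡b → 1+i≢a+b (trans (sym (+-suc a t)) (cong (a +_) 1+t≡b))))
  ... | second t t<b = ascent-second t<b
  ... | above a+2b≤i = begin-strict
    blockSwap a b i        ≡⟨ blockSwap-above a+2b≤i ⟩
    i                      <⟨ n<1+n i ⟩
    suc i                  ≡⟨ sym (blockSwap-above (m≤n⇒m≤1+n a+2b≤i)) ⟩
    blockSwap a b (suc i)  ∎
    where open ≤-Reasoning

  blockSwap-atMostOneDescent : AtMostOneDescentℕ (blockSwap a b)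
  blockSwap-atMostOneDescent i j dᵢ dⱼ = suc-injective (trans (descent⇒ dᵢ) (sym (descent⇒ dⱼ)))
    where
    descent⇒ : ∀ {k} → Descent (blockSwap a b) k → suc k ≡ a + b
    descent⇒ {k} d with suc k ≟ a + b
    ... | yes 1+k≡a+b = 1+k≡a+b
    ... | no 1+k≢a+b = contradiction (blockSwap-ascent 1+k≢a+b) (<-asym d)

Code : Set
Code = ℕ × ℕ

size : Code → ℕ
size (a , b) = a + b + b

ValidCode : ℕ → Code → Set
ValidCode n c = 0 < proj₂ c × size c ≤ n

validCode⇒< : ∀ {n a b} → ValidCode n (a , b) → a < n
validCode⇒< {a = a} {b} (0<b , fits) = <-≤-trans (m<m+n a 0<b) (≤-trans (m≤m+n (a + b) b) fits)

blockSwap-injective : ∀ {m a b a′ b′} → ValidCode m (a , b) → ValidCode m (a′ , b′) →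
                      (∀ {i} → i < m → blockSwap a b i ≡ blockSwap a′ b′ i) → (a , b) ≡ (a′ , b′)
blockSwap-injective {a = a} {b} {a′} {b′} valid@(0<b , _) valid′@(0<b′ , _) agree with <-cmp a a′
... | tri< a<a′ _ _ = contradiction
  (trans (sym (blockSwap-moves-a 0<b)) (trans (agree (validCode⇒< valid)) (blockSwap-below a<a′)))
  (>⇒≢ (m<m+n a 0<b))
... | tri> _ _ a′<a = contradiction
  (trans (sym (blockSwap-below a′<a)) (trans (agree (validCode⇒< valid′)) (blockSwap-moves-a 0<b′)))
  (<⇒≢ (m<m+n a′ 0<b′))
... | tri≈ _ refl _ = cong (a ,_) (+-cancelˡ-≡ a b b′
  (trans (sym (blockSwap-moves-a 0<b)) (trans (agree (validCode⇒< valid)) (blockSwap-moves-a 0<b′))))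

module Classification {n : ℕ} {g : ℕ → ℕ} (involutive : Involutive g)
  (fixed-above : ∀ i → n ≤ i → g i ≡ i) (atMostOne : AtMostOneDescentℕ g) where

  ascent : ∀ {k} → ¬ Descent g k → g k < g (suc k)
  ascent {k} ¬descent = ≤∧≢⇒< (≮⇒≥ ¬descent) (λ gk≡g1+k → 1+n≢n (sym (injective gk≡g1+k)))
    where
    injective : ∀ {x y} → g x ≡ g y → x ≡ y
    injective {x} {y} gx≡gy = trans (sym (involutive x)) (trans (cong g gx≡gy) (involutive y))

  no-descent⇒identity : (∀ k → ¬ Descent g k) → ∀ i → g i ≡ i
  no-descent⇒identity none i =
    expanding-involution-fixed {R = λ _ → ⊤} expanding involutive tt tt
    where
    expanding : Expanding g (λ _ → ⊤)
    expanding j k _ _ = ascents⇒expanding {g = g} j k (λ t _ → ascent (none (j + t)))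

  module AtDescent (d : ℕ) (descent : Descent g d) where

    ascent-elsewhere : ∀ {k} → k ≢ d → g k < g (suc k)
    ascent-elsewhere k≢d = ascent (λ descent′ → k≢d (atMostOne _ _ descent′ descent))

    expanding-below : Expanding g (_≤ d)
    expanding-below i k _ i+k≤d =
      ascents⇒expanding {g = g} i k λ t t<k →
        ascent-elsewhere (<⇒≢ (<-≤-trans (+-monoʳ-< i t<k) i+k≤d))

    expanding-above : Expanding g (d <_)
    expanding-above i k d<i _ =
      ascents⇒expanding {g = g} i k (λ t _ → ascent-elsewhere (>⇒≢ (<-≤-trans d<i (m≤m+n i t))))

    a : ℕ
    a = g (suc d)

    a≤d : a ≤ d
    a≤d = ≮⇒≥ λ d<a → <-asym d<a (subst (a <_) (involutive d)
      (expanding⇒< expanding-above (n<1+n d) (<-trans d<a descent) (≤-<-trans d<a descent)))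

    b′ : ℕ
    b′ = d ∸ a

    b : ℕ
    b = suc b′

    a+b≡1+d : a + b ≡ suc d
    a+b≡1+d = trans (+-suc a b′) (cong suc (m+[n∸m]≡n a≤d))

    above-d : ∀ {x} → a + b ≤ x → d < x
    above-d {x} = subst (_≤ x) a+b≡1+d

    g-below : ∀ {i} → i < a → g i ≡ i
    g-below {i} i<a = expanding-involution-fixed expanding-below involutive i≤d gi≤d
      where
      i≤d : i ≤ d
      i≤d = ≤-trans (<⇒≤ i<a) a≤d
      gi≤d : g i ≤ d
      gi≤d = ≤-pred (subst (g i <_) (involutive (suc d)) (expanding⇒< expanding-below i≤d a≤d i<a))

    -- The lower bound is expansion below d from g a = a + b. If g (a + t) overshot a + b + t,
    -- monotonicity above d would give g (a + b + t) < a + t, against expansion from g (a + b) = a.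
    g-first : ∀ {t} → t < b → g (a + t) ≡ a + b + t
    g-first {t} t<b = ≤-antisym (≮⇒≥ overshoot) lower
      where
      a+t≤d : a + t ≤ d
      a+t≤d = ≤-pred (subst (a + t <_) a+b≡1+d (+-monoʳ-< a t<b))
      lower : a + b + t ≤ g (a + t)
      lower = subst (λ x → x + t ≤ g (a + t)) (trans (involutive (suc d)) (sym a+b≡1+d))
                (expanding-below a t a≤d a+t≤d)
      partner : a + t ≤ g (a + b + t)
      partner = subst (λ x → a + t ≤ g (x + t)) (sym a+b≡1+d)
                  (expanding-above (suc d) t (n<1+n d) (s≤s (m≤m+n d t)))
      overshoot : ¬ (a + b + t < g (a + t))
      overshoot a+b+t<g = <⇒≱ (subst (g (a + b + t) <_) (involutive (a + t))
        (expanding⇒< expanding-above d<a+b+t (<-trans d<a+b+t a+b+t<g) a+b+t<g)) partner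
        where
        d<a+b+t : d < a + b + t
        d<a+b+t = above-d (m≤m+n (a + b) t)

    g-second : ∀ {t} → t < b → g (a + b + t) ≡ a + t
    g-second {t} t<b = trans (cong g (sym (g-first t<b))) (involutive (a + t))

    g≡blockSwap-inside : ∀ i → i < a + b + b → g i ≡ blockSwap a b i
    g≡blockSwap-inside i i<a+2b with region a b i
    ... | below i<a    = trans (g-below i<a) (sym (blockSwap-below i<a))
    ... | first t t<b  = trans (g-first t<b) (sym (blockSwap-first t<b))
    ... | second t t<b = trans (g-second t<b) (sym (blockSwap-second t<b))
    ... | above a+2b≤i = contradiction i<a+2b (≤⇒≯ a+2b≤i)

    -- g agrees with the block swap on [0, a + 2b), which it thus maps onto itself.
    g-above : ∀ {i} → a + b + b ≤ i → g i ≡ i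
    g-above {i} a+2b≤i = expanding-involution-fixed expanding-above involutive
      (above-d (≤-trans (m≤m+n (a + b) b) a+2b≤i)) (above-d (≤-trans (m≤m+n (a + b) b) a+2b≤gi))
      where
      a+2b≤gi : a + b + b ≤ g i
      a+2b≤gi = ≮⇒≥ λ gi<a+2b → <⇒≱
        (subst (_< a + b + b) (trans (sym (g≡blockSwap-inside (g i) gi<a+2b)) (involutive i))
          (blockSwap-< ≤-refl gi<a+2b))
        a+2b≤i

    g≡blockSwap : ∀ i → g i ≡ blockSwap a b i
    g≡blockSwap i with i <? a + b + b
    ... | yes i<a+2b = g≡blockSwap-inside i i<a+2b
    ... | no i≮a+2b  = trans (g-above (≮⇒≥ i≮a+2b)) (sym (blockSwap-above (≮⇒≥ i≮a+2b)))

    -- The last point a + b + b′ of the second block is moved, so it lies below n.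
    fits : a + b + b ≤ n
    fits = ≮⇒≥ λ n<a+2b → <-irrefl
      (trans (sym (g-second (n<1+n b′))) (fixed-above _ (last≥n n<a+2b)))
      (+-monoˡ-< b′ (m<m+n a z<s))
      where
      last≥n : n < a + b + b → n ≤ a + b + b′
      last≥n n<a+2b = ≤-pred (subst (n <_) (+-suc (a + b) b′) n<a+2b)

  classify : (∀ i → g i ≡ i) ⊎ ∃₂ λ a b → ValidCode n (a , b) × (∀ i → g i ≡ blockSwap a b i)
  classify with anyUpTo? (λ k → g (suc k) <? g k) n
  ... | yes (d , _ , descent) = inj₂ (a , b , (z<s , fits) , g≡blockSwap)
    where open AtDescent d descent
  ... | no none = inj₁ (no-descent⇒identity (λ k descent → none (k , below-n descent , descent)))
    where
    below-n : ∀ {k} → Descent g k → k < n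
    below-n {k} descent = ≰⇒> λ n≤k → <-asym (n<1+n k)
      (subst₂ _<_ (fixed-above (suc k) (m≤n⇒m≤1+n n≤k)) (fixed-above k n≤k) descent)

module _ {n : ℕ} where

  record Tracks (π : Permutation′ n) (h : ℕ → ℕ) : Set where
    constructor tracking
    field commutes : ∀ k → toℕ (π ⟨$⟩ʳ k) ≡ h (toℕ k)

  open Tracks

  module _ {π : Permutation′ n} {h : ℕ → ℕ} (tracks : Tracks π h) where

    tracks-fromℕ< : ∀ {i} (i<n : i < n) → toℕ (π ⟨$⟩ʳ fromℕ< i<n) ≡ h i
    tracks-fromℕ< i<n = trans (commutes tracks (fromℕ< i<n)) (cong h (toℕ-fromℕ< i<n))

    tracks-< : ∀ {i} → i < n → h i < n
    tracks-< i<n = subst (_< n) (tracks-fromℕ< i<n) (toℕ<n _)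

    tracks-cong : ∀ {h′} → (∀ i → h i ≡ h′ i) → Tracks π h′
    tracks-cong h≗h′ = tracking λ k → trans (commutes tracks k) (h≗h′ (toℕ k))

    tracks-descent : ∀ {i} (p : suc i < n) → HasDescentAt π i p ⇔ Descent h i
    tracks-descent p = mk⇔ (subst₂ _<_ e₁ e₂) (subst₂ _<_ (sym e₁) (sym e₂))
      where
      e₁ : toℕ (π ⟨$⟩ʳ fromℕ< p) ≡ h (suc _)
      e₁ = tracks-fromℕ< p
      e₂ : toℕ (π ⟨$⟩ʳ fromℕ< (<-trans (n<1+n _) p)) ≡ h _
      e₂ = tracks-fromℕ< (<-trans (n<1+n _) p)

    tracks⇒isInvolution : Involutive h → IsInvolution π
    tracks⇒isInvolution involutive k = toℕ-injective (begin
      toℕ (π ⟨$⟩ʳ (π ⟨$⟩ʳ k))  ≡⟨ commutes tracks (π ⟨$⟩ʳ k) ⟩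
      h (toℕ (π ⟨$⟩ʳ k))       ≡⟨ cong h (commutes tracks k) ⟩
      h (h (toℕ k))            ≡⟨ involutive (toℕ k) ⟩
      toℕ k                    ∎)
      where open ≡-Reasoning

    tracks⇒atMostOneDescent : AtMostOneDescentℕ h → AtMostOneDescent π
    tracks⇒atMostOneDescent atMostOne i j p q dᵢ dⱼ =
      atMostOne i j (Equivalence.to (tracks-descent p) dᵢ) (Equivalence.to (tracks-descent q) dⱼ)

    tracks⇒good : Involutive h → AtMostOneDescentℕ h → Good π
    tracks⇒good involutive atMostOne = tracks⇒atMostOneDescent atMostOne , tracks⇒isInvolution involutive

    module _ (fixed-above : ∀ i → n ≤ i → h i ≡ i) where

      isInvolution⇒involutive : IsInvolution π → Involutive h
      isInvolution⇒involutive involution i with i <? n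
      ... | yes i<n = begin
        h (h i)                   ≡⟨ cong h (sym (tracks-fromℕ< i<n)) ⟩
        h (toℕ (π ⟨$⟩ʳ k))        ≡⟨ sym (commutes tracks (π ⟨$⟩ʳ k)) ⟩
        toℕ (π ⟨$⟩ʳ (π ⟨$⟩ʳ k))   ≡⟨ cong toℕ (involution k) ⟩
        toℕ k                     ≡⟨ toℕ-fromℕ< i<n ⟩
        i                         ∎
        where
        open ≡-Reasoning
        k : Fin n
        k = fromℕ< i<n
      ... | no i≮n = trans (cong h (fixed-above i n≤i)) (fixed-above i n≤i)
        where
        n≤i : n ≤ i
        n≤i = ≮⇒≥ i≮n

      atMostOneDescent⇒atMostOneDescentℕ : AtMostOneDescent π → AtMostOneDescentℕ h
      atMostOneDescent⇒atMostOneDescentℕ atMostOne i j dᵢ dⱼ = atMostOne i j (inside dᵢ) (inside dⱼ)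
        (Equivalence.from (tracks-descent (inside dᵢ)) dᵢ)
        (Equivalence.from (tracks-descent (inside dⱼ)) dⱼ)
        where
        h≤ : ∀ {k} → n ≤ suc k → h k ≤ k
        h≤ {k} n≤1+k with k <? n
        ... | yes k<n = ≤-pred (≤-trans (tracks-< k<n) n≤1+k)
        ... | no k≮n  = ≤-reflexive (fixed-above k (≮⇒≥ k≮n))
        inside : ∀ {k} → Descent h k → suc k < n
        inside {k} descent = ≰⇒> λ n≤1+k → <-asym descent
          (≤-<-trans (h≤ n≤1+k) (subst (k <_) (sym (fixed-above (suc k) n≤1+k)) (n<1+n k)))

  tracks-unique : ∀ {π ρ h} → Tracks π h → Tracks ρ h → π ≈ₚ ρ
  tracks-unique π-tracks ρ-tracks k =
    toℕ-injective (trans (commutes π-tracks k) (sym (commutes ρ-tracks k)))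

  ≈ₚ⇒agree : ∀ {π ρ h h′} → π ≈ₚ ρ → Tracks π h → Tracks ρ h′ → ∀ {i} → i < n → h i ≡ h′ i
  ≈ₚ⇒agree π≈ρ π-tracks ρ-tracks i<n =
    trans (sym (tracks-fromℕ< π-tracks i<n)) (trans (cong toℕ (π≈ρ _)) (tracks-fromℕ< ρ-tracks i<n))

  id-tracks : Tracks id (λ i → i)
  id-tracks = tracking λ _ → refl

  extend : Permutation′ n → ℕ → ℕ
  extend π i with i <? n
  ... | yes i<n = toℕ (π ⟨$⟩ʳ fromℕ< i<n)
  ... | no _    = i

  extend-tracks : ∀ π → Tracks π (extend π)
  extend-tracks π = tracking commutes-extend
    where
    commutes-extend : ∀ k → toℕ (π ⟨$⟩ʳ k) ≡ extend π (toℕ k)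
    commutes-extend k with toℕ k <? n
    ... | yes k<n = cong (λ j → toℕ (π ⟨$⟩ʳ j)) (sym (fromℕ<-toℕ k k<n))
    ... | no k≮n  = contradiction (toℕ<n k) k≮n

  extend-above : ∀ π i → n ≤ i → extend π i ≡ i
  extend-above π i n≤i with i <? n
  ... | yes i<n = contradiction i<n (≤⇒≯ n≤i)
  ... | no _    = refl

  fromInvolution : (h : ℕ → ℕ) → Involutive h → (∀ {i} → i < n → h i < n) → Permutation′ n
  fromInvolution h involutive h-< = permutation f f f∘f f∘f
    where
    f : Fin n → Fin n
    f k = fromℕ< (h-< (toℕ<n k))
    f∘f : ∀ k → f (f k) ≡ k
    f∘f k = toℕ-injective (trans (toℕ-fromℕ< _) (trans (cong h (toℕ-fromℕ< _)) (involutive (toℕ k))))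

  -- Codes whose blocks do not fit into [0, n) get the junk value id.
  blockSwapPerm : Code → Permutation′ n
  blockSwapPerm (a , b) with a + b + b ≤? n
  ... | yes fits = fromInvolution (blockSwap a b) blockSwap-involutive (blockSwap-< fits)
  ... | no _     = id

  blockSwapPerm-tracks : ∀ a b → a + b + b ≤ n → Tracks (blockSwapPerm (a , b)) (blockSwap a b)
  blockSwapPerm-tracks a b fits with a + b + b ≤? n
  ... | yes _     = tracking λ _ → toℕ-fromℕ< _
  ... | no ¬fits  = contradiction fits ¬fits

  blockSwapPerm-good : ∀ {c} → ValidCode n c → Good (blockSwapPerm c)
  blockSwapPerm-good {a , b} (_ , fits) =
    tracks⇒good (blockSwapPerm-tracks a b fits) blockSwap-involutive blockSwap-atMostOneDescent

  id-good : Good (id {n})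
  id-good = tracks⇒good id-tracks (λ _ → refl) (λ i _ d _ → contradiction d (<-asym (n<1+n i)))

  good⇒identity⊎blockSwap : ∀ π → Good π →
                            π ≈ₚ id ⊎ ∃₂ λ a b → ValidCode n (a , b) × π ≈ₚ blockSwapPerm (a , b)
  good⇒identity⊎blockSwap π (atMostOne , involution) with classify
    where
    open Classification (isInvolution⇒involutive (extend-tracks π) (extend-above π) involution)
      (extend-above π) (atMostOneDescent⇒atMostOneDescentℕ (extend-tracks π) (extend-above π) atMostOne)
  ... | inj₁ identity = inj₁ (tracks-unique (tracks-cong (extend-tracks π) identity) id-tracks)
  ... | inj₂ (a , b , valid , ≗blockSwap) =
    inj₂ (a , b , valid ,
      tracks-unique (tracks-cong (extend-tracks π) ≗blockSwap) (blockSwapPerm-tracks a b (proj₂ valid)))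

  blockSwapPerm-injective : ∀ {c c′} → ValidCode n c → ValidCode n c′ →
                            blockSwapPerm c ≈ₚ blockSwapPerm c′ → c ≡ c′
  blockSwapPerm-injective {a , b} {a′ , b′} valid valid′ σ≈σ′ = blockSwap-injective valid valid′
    (≈ₚ⇒agree σ≈σ′ (blockSwapPerm-tracks a b (proj₂ valid))
                   (blockSwapPerm-tracks a′ b′ (proj₂ valid′)))

  id≉blockSwapPerm : ∀ {c} → ValidCode n c → ¬ (id ≈ₚ blockSwapPerm c)
  id≉blockSwapPerm {a , b} valid@(0<b , fits) id≈σ = <⇒≢ (m<m+n a 0<b)
    (trans (≈ₚ⇒agree id≈σ id-tracks (blockSwapPerm-tracks a b fits) (validCode⇒< valid))
           (blockSwap-moves-a 0<b))

codesOfSize : ℕ → List Code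
codesOfSize zero          = []
codesOfSize (suc zero)    = []
codesOfSize (suc (suc m)) = (m , 1) ∷ map (map₂ suc) (codesOfSize m)

codesUpTo : ℕ → List Code
codesUpTo zero    = []
codesUpTo (suc n) = codesUpTo n ++ codesOfSize (suc n)

HasSize : ℕ → Code → Set
HasSize m c = 0 < proj₂ c × size c ≡ m

size-suc : ∀ a b → a + suc b + suc b ≡ suc (suc (a + b + b))
size-suc = solve-∀

codesOfSize-hasSize : ∀ m → All (HasSize m) (codesOfSize m)
codesOfSize-hasSize zero          = []
codesOfSize-hasSize (suc zero)    = []
codesOfSize-hasSize (suc (suc m)) = (z<s , size-one m) ∷ All.map⁺ (All.map grow (codesOfSize-hasSize m))
  where
  size-one : ∀ m → m + 1 + 1 ≡ suc (suc m)
  size-one = solve-∀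
  grow : ∀ {c} → HasSize m c → HasSize (suc (suc m)) (map₂ suc c)
  grow {a , b} (_ , size≡m) = z<s , trans (size-suc a b) (cong (λ x → suc (suc x)) size≡m)

codesOfSize-unique : ∀ m → AllPairs _≢_ (codesOfSize m)
codesOfSize-unique zero          = []
codesOfSize-unique (suc zero)    = []
codesOfSize-unique (suc (suc m)) =
  All.map⁺ (All.map head-distinct (codesOfSize-hasSize m))
  ∷ AllPairs.map⁺ (AllPairs.map (λ c≢c′ eq → c≢c′ (cong (map₂ pred) eq)) (codesOfSize-unique m))
  where
  head-distinct : ∀ {c} → HasSize m c → (m , 1) ≢ map₂ suc c
  head-distinct (0<b , _) eq = <-irrefl (suc-injective (cong proj₂ eq)) 0<b

∈-codesOfSize : ∀ a b → 0 < b → (a , b) ∈ codesOfSize (a + b + b)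
∈-codesOfSize a (suc zero) _ =
  subst (λ m → (a , 1) ∈ codesOfSize m) (sym (size-suc a 0)) (here (cong (_, 1) (sym (a+0+0≡a a))))
  where
  a+0+0≡a : ∀ a → a + 0 + 0 ≡ a
  a+0+0≡a = solve-∀
∈-codesOfSize a (suc (suc b)) _ =
  subst (λ m → (a , suc (suc b)) ∈ codesOfSize m) (sym (size-suc a (suc b)))
    (there (∈-map⁺ (map₂ suc) (∈-codesOfSize a (suc b) z<s)))

length-codesOfSize : ∀ m → length (codesOfSize m) + length (codesOfSize (suc m)) ≡ m
length-codesOfSize zero    = refl
length-codesOfSize (suc m) = begin
  length (codesOfSize (suc m)) + suc (length (map (map₂ suc) (codesOfSize m)))
    ≡⟨ cong (λ x → length (codesOfSize (suc m)) + suc x) (length-map (map₂ suc) (codesOfSize m)) ⟩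
  length (codesOfSize (suc m)) + suc (length (codesOfSize m))
    ≡⟨ +-suc (length (codesOfSize (suc m))) _ ⟩
  suc (length (codesOfSize (suc m)) + length (codesOfSize m))
    ≡⟨ cong suc (+-comm (length (codesOfSize (suc m))) _) ⟩
  suc (length (codesOfSize m) + length (codesOfSize (suc m)))
    ≡⟨ cong suc (length-codesOfSize m) ⟩
  suc m ∎
  where open ≡-Reasoning

codesUpTo-valid : ∀ n → All (ValidCode n) (codesUpTo n)
codesUpTo-valid zero    = []
codesUpTo-valid (suc n) = All.++⁺
  (All.map (λ (0<b , fits) → 0<b , m≤n⇒m≤1+n fits) (codesUpTo-valid n))
  (All.map (λ (0<b , size≡) → 0<b , ≤-reflexive size≡) (codesOfSize-hasSize (suc n)))

codesUpTo-unique : ∀ n → AllPairs _≢_ (codesUpTo n)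
codesUpTo-unique zero    = []
codesUpTo-unique (suc n) = AllPairs.++⁺ (codesUpTo-unique n) (codesOfSize-unique (suc n))
  (All.map (λ valid → All.map (distinct valid) (codesOfSize-hasSize (suc n))) (codesUpTo-valid n))
  where
  distinct : ∀ {c c′} → ValidCode n c → HasSize (suc n) c′ → c ≢ c′
  distinct (_ , fits) (_ , size≡) refl = 1+n≰n (subst (_≤ n) size≡ fits)

∈-codesUpTo : ∀ {n a b} → ValidCode n (a , b) → (a , b) ∈ codesUpTo n
∈-codesUpTo {zero} {a} {b} (0<b , fits) = contradiction fits (<⇒≱ (<-≤-trans 0<b (m≤n+m b (a + b))))
∈-codesUpTo {suc n} {a} {b} (0<b , fits) with m≤n⇒m<n∨m≡n fits
... | inj₁ a+2b<1+n = ∈-++⁺ˡ (∈-codesUpTo (0<b , ≤-pred a+2b<1+n))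
... | inj₂ a+2b≡1+n =
  ∈-++⁺ʳ (codesUpTo n) (subst (λ m → (a , b) ∈ codesOfSize m) a+2b≡1+n (∈-codesOfSize a b 0<b))

length-codesUpTo : ∀ n → length (codesUpTo n) ≡ n * n / 4
length-codesUpTo zero          = refl
length-codesUpTo (suc zero)    = refl
length-codesUpTo (suc (suc n)) = begin
  length ((codesUpTo n ++ codesOfSize (suc n)) ++ codesOfSize (suc (suc n)))
    ≡⟨ length-++ (codesUpTo n ++ codesOfSize (suc n)) ⟩
  length (codesUpTo n ++ codesOfSize (suc n)) + length (codesOfSize (suc (suc n)))
    ≡⟨ cong (_+ length (codesOfSize (suc (suc n)))) (length-++ (codesUpTo n)) ⟩
  length (codesUpTo n) + length (codesOfSize (suc n)) + length (codesOfSize (suc (suc n)))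
    ≡⟨ +-assoc (length (codesUpTo n)) _ _ ⟩
  length (codesUpTo n) + (length (codesOfSize (suc n)) + length (codesOfSize (suc (suc n))))
    ≡⟨ cong₂ _+_ (length-codesUpTo n) (length-codesOfSize (suc n)) ⟩
  n * n / 4 + suc n
    ≡⟨ cong (n * n / 4 +_) (sym (m*n/n≡m (suc n) 4)) ⟩
  n * n / 4 + suc n * 4 / 4
    ≡⟨ sym (+-distrib-/-∣ʳ (n * n) (n∣m*n (suc n))) ⟩
  (n * n + suc n * 4) / 4
    ≡⟨ cong (_/ 4) (square-step n) ⟩
  suc (suc n) * suc (suc n) / 4 ∎
  where
  open ≡-Reasoning
  square-step : ∀ n → n * n + suc n * 4 ≡ suc (suc n) * suc (suc n)
  square-step = solve-∀

blockSwapPerms-distinct : ∀ n → AllPairs (λ π ρ → ¬ (π ≈ₚ ρ)) (map (blockSwapPerm {n}) (codesUpTo n))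
blockSwapPerms-distinct n = AllPairs.map⁺ (AllPairs-mapWith-All
  (λ valid valid′ c≢c′ σ≈σ′ → c≢c′ (blockSwapPerm-injective valid valid′ σ≈σ′))
  (codesUpTo-valid n) (codesUpTo-unique n))

theorem2p3 : (n : ℕ) → n ≥ 1 → CountIs n Good ((n * n) / 4 + 1)
theorem2p3 n _ = id ∷ map blockSwapPerm (codesUpTo n) , counted , good , distinct , complete
  where
  counted : 1 + length (map blockSwapPerm (codesUpTo n)) ≡ n * n / 4 + 1
  counted = trans (cong suc (trans (length-map blockSwapPerm (codesUpTo n)) (length-codesUpTo n)))
                  (+-comm 1 _)
  good : All Good (id ∷ map blockSwapPerm (codesUpTo n))
  good = id-good ∷ All.map⁺ (All.map blockSwapPerm-good (codesUpTo-valid n))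
  distinct : AllPairs (λ π ρ → ¬ (π ≈ₚ ρ)) (id ∷ map blockSwapPerm (codesUpTo n))
  distinct = All.map⁺ (All.map id≉blockSwapPerm (codesUpTo-valid n)) ∷ blockSwapPerms-distinct n
  complete : (π : Permutation′ n) → Good π → Any (π ≈ₚ_) (id ∷ map blockSwapPerm (codesUpTo n))
  complete π good-π with good⇒identity⊎blockSwap π good-π
  ... | inj₁ π≈id = here π≈id
  ... | inj₂ (a , b , valid , π≈σ) = there (Any.map (λ σ≡ → subst (π ≈ₚ_) σ≡ π≈σ)
                                               (∈-map⁺ blockSwapPerm (∈-codesUpTo valid)))
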